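{- Let $B,m$ be positive integers with $m<B$ and let $a_1,\ldots,a_{3m}$ be positive integers with $\sum_{j=1}^{3m}a_j=mB$ and $B/4<a_j<B/2$ for all $j$. Let $L=mB^3+Bm(m+1)/2$ and for $i=1,\ldots,m$ let $I_i=[l_i,r_i)$ with $l_i=(i-1)B^3+\frac{(i-1)i}{2}B$ and $r_i=iB^3+\frac{i(i+1)}{2}B$. Consider the task set $\mathcal{J}\cup\widetilde{\mathcal{J}}$, where $\mathcal{J}=\{J_1,\ldots,J_{3m}\}$ with $J_j$ having deadline $L$ and execution time $p_j(t)=ia_j$ for $t\in I_i$, and $\widetilde{\mathcal{J}}=\{\widetilde{J}_1,\ldots,\widetilde{J}_m\}$ with $\widetilde{J}_i$ having deadline $l_i+B^3$ and execution time $B^3$ for every start time. Let $D$ be a feasible schedule for $\mathcal{J}\cup\widetilde{\mathcal{J}}$, in which $\widetilde{J}_i$ starts at $\widetilde{s}_i$ and completes at $\widetilde{C}_i$, and define $\widetilde{I}_i=[\widetilde{C}_i,\widetilde{s}_{i+1})$ for $i=1,\ldots,m-1$ and $\widetilde{I}_m=[\widetilde{C}_m,L)$. Then the length of $\widetilde{I}_i$ equals $iB$ for each $i=1,\ldots,m$.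
   Context: A (feasible) single-machine schedule for time-dependent tasks assigns to each task $J$ a start time $s\ge 0$; its completion time is $s+p(s)$, where $p$ is its execution-time function. Execution intervals $[s,s+p(s))$ of distinct tasks must be pairwise disjoint and each completion time must not exceed the task's deadline.
   Formalization: The feasible schedule D has only rational start and completion times, so the times $\widetilde{s}_i$ and $\widetilde{C}_i$ are rational as well. -}

module Defs where

open import Data.Nat as ℕ using (ℕ; suc; _∸_)
open import Data.Nat.DivMod using () renaming (_/_ to _div_)
open import Data.Integer using (+_)
open import Data.Rational using (ℚ; _/_; _+_; _-_; _≤_; _<_; 0ℚ)
open import Data.Fin using (Fin; toℕ; fromℕ<)
open import Data.Sum using (_⊎_; inj₁; inj₂)
open import Data.Product using (Σ; ∃; _×_)
open import Relation.Binary.PropositionalEquality using (_≡_; _≢_)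
open import Relation.Nullary using (yes; no)
open import Data.Empty using (⊥)

⟦_⟧ : ℕ → ℚ
⟦ n ⟧ = + n / 1

-- L = m B^3 + B m(m+1)/2   (computed in ℕ; m(m+1) is even, so division is exact)
Lℕ : (B m : ℕ) → ℕ
Lℕ B m = m ℕ.* (B ℕ.^ 3) ℕ.+ B ℕ.* ((m ℕ.* suc m) div 2)

-- For the 1-based index i = k+1 (k : Fin m):
--   l_i = (i-1) B^3 + (i-1) i / 2 * B ,   r_i = i B^3 + i (i+1) / 2 * B
lℕ : (B k : ℕ) → ℕ
lℕ B k = k ℕ.* (B ℕ.^ 3) ℕ.+ ((k ℕ.* suc k) div 2) ℕ.* B

rℕ : (B k : ℕ) → ℕ
rℕ B k = suc k ℕ.* (B ℕ.^ 3) ℕ.+ ((suc k ℕ.* suc (suc k)) div 2) ℕ.* B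

InI : (B k : ℕ) → ℚ → Set
InI B k t = ⟦ lℕ B k ⟧ ≤ t × t < ⟦ rℕ B k ⟧

-- Tasks: inj₁ j is J_{j+1} (j : Fin (3m)), inj₂ i is J̃_{i+1} (i : Fin m)
Task : ℕ → Set
Task m = Fin (3 ℕ.* m) ⊎ Fin m

record FeasibleSchedule (B m : ℕ) (a : Fin (3 ℕ.* m) → ℕ) : Set where
  field
    start : Task m → ℚ
    comp  : Task m → ℚ
    start-nonneg : ∀ x → 0ℚ ≤ start x
    -- J_j : p_j(t) = i a_j for t ∈ I_i (i = 1..m); p_j is defined only on the
    -- union of the I_i = [0, L), so the start time must lie in some I_i
    comp-J : ∀ j → Σ ℕ λ k → k ℕ.< m × InI B k (start (inj₁ j))
               × comp (inj₁ j) ≡ start (inj₁ j) + ⟦ suc k ℕ.* a j ⟧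
    comp-J̃ : ∀ i → comp (inj₂ i) ≡ start (inj₂ i) + ⟦ B ℕ.^ 3 ⟧
    deadline-J : ∀ j → comp (inj₁ j) ≤ ⟦ Lℕ B m ⟧
    deadline-J̃ : ∀ i → comp (inj₂ i) ≤ ⟦ lℕ B (toℕ i) ℕ.+ B ℕ.^ 3 ⟧
    disjoint : ∀ x y → x ≢ y → ∀ (t : ℚ) →
               start x ≤ t → t < comp x → start y ≤ t → t < comp y → ⊥

-- right endpoint of Ĩ_{k+1}: s̃_{k+2} if k+1 < m, and L otherwise
gapEnd : (B m : ℕ) → (Fin m → ℚ) → (k : Fin m) → ℚ
gapEnd B m s̃ k with suc (toℕ k) ℕ.<? m
... | yes h = s̃ (fromℕ< h)
... | no _  = ⟦ Lℕ B m ⟧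

module Submission where

-- Indices start at 0 here: J̃-task i is the paper's J̃_{i+1}, window k is I_{k+1} =
-- [l_k, l_{k+1}) with l_k = k·B³ + k(k+1)/2·B (and l_m = L).  A J-task has level k if it
-- starts in window k, and J̃-task i has level i.  N_k is the total size Σ a_j of the J-tasks
-- of level k, and the fence S_K is the start of J̃_K for K < m and L for K = m.
--
--  * J̃_K starts by l_K < (K+1)·B³ (as K < m < B) and, by induction on K, not before K·B³.
--    Hence every task of level < K completes by S_K, and S_K ≤ l_K.
--  * Packing: pairwise disjoint intervals inside [0, S_K) have total length ≤ S_K.  The
--    tasks of level < K have total length K·B³ + Σ_{k<K} (k+1)·N_k, and l_K = K·B³ +
--    Σ_{k<K} (k+1)·B, so Σ_{k<K} (k+1)·N_k ≤ Σ_{k<K} (k+1)·B for every K ≤ m.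
--  * Rigidity of weighted prefix sums (summation by parts): with Σ_{k<m} N_k = m·B these
--    inequalities force N_k = B for all k < m; then the two bounds on S_K meet: S_K = l_K.
--  * So the gap after J̃-task i, [S_i + B³, S_{i+1}), has length l_{i+1} - l_i - B³ = (i+1)·B.

open import Data.Nat as ℕ using (ℕ; suc)
open import Data.Fin using (Fin; toℕ)
open import Data.List using (tabulate)
open import Data.Nat.ListAction using (sum)
open import Data.Sum using (inj₂)
open import Relation.Binary.PropositionalEquality using (_≡_; cong; cong₂; module ≡-Reasoning)
open import Defs

module Embedding where
  open import Defs using (⟦_⟧)
  open import Data.Nat as ℕ using (ℕ)
  open import Data.Nat.Divisibility using (∣1⇒≡1)
  open import Data.Integer as ℤ using (+_)
  import Data.Integer.Properties as ℤP
  open import Data.Rational as ℚ using (ℚ; mkℚ; 0ℚ; _+_; _-_; -_; _≤_; _<_)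
  import Data.Rational.Properties as ℚP
  open import Data.Rational.Solver using (module +-*-Solver)
  open +-*-Solver using (solve; _:=_; _:+_; _:-_; :-_)
  open import Data.Product using (proj₂)
  open import Relation.Binary.PropositionalEquality

  ⟦⟧-normal : ∀ n → ⟦ n ⟧ ≡ mkℚ (+ n) 0 (λ {d} p → ∣1⇒≡1 (proj₂ p))
  ⟦⟧-normal n = ℚP.normalize-coprime {n} {0} (λ {d} p → ∣1⇒≡1 (proj₂ p))

  ⟦+⟧ : ∀ m n → ⟦ m ℕ.+ n ⟧ ≡ ⟦ m ⟧ + ⟦ n ⟧
  ⟦+⟧ m n = trans (cong (ℚ._/ 1) numerators) (sym (cong₂ _+_ (⟦⟧-normal m) (⟦⟧-normal n)))
    where
    numerators : + (m ℕ.+ n) ≡ (+ m ℤ.* + 1) ℤ.+ (+ n ℤ.* + 1)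
    numerators = sym (cong₂ ℤ._+_ (ℤP.*-identityʳ (+ m)) (ℤP.*-identityʳ (+ n)))

  ⟦≤⟧ : ∀ {m n} → m ℕ.≤ n → ⟦ m ⟧ ≤ ⟦ n ⟧
  ⟦≤⟧ {m} {n} m≤n rewrite ⟦⟧-normal m | ⟦⟧-normal n =
    ℚ.*≤* (subst₂ ℤ._≤_ (sym (ℤP.*-identityʳ (+ m))) (sym (ℤP.*-identityʳ (+ n))) (ℤ.+≤+ m≤n))

  ⟦<⟧ : ∀ {m n} → m ℕ.< n → ⟦ m ⟧ < ⟦ n ⟧
  ⟦<⟧ {m} {n} m<n rewrite ⟦⟧-normal m | ⟦⟧-normal n =
    ℚ.*<* (subst₂ ℤ._<_ (sym (ℤP.*-identityʳ (+ m))) (sym (ℤP.*-identityʳ (+ n))) (ℤ.+<+ m<n))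

  ⟦≤⟧⁻ : ∀ {m n} → ⟦ m ⟧ ≤ ⟦ n ⟧ → m ℕ.≤ n
  ⟦≤⟧⁻ {m} {n} h rewrite ⟦⟧-normal m | ⟦⟧-normal n =
    ℤP.drop‿+≤+ (subst₂ ℤ._≤_ (ℤP.*-identityʳ (+ m)) (ℤP.*-identityʳ (+ n)) (ℚP.drop-*≤* h))

  ⟦⟧-nonneg : ∀ n → 0ℚ ≤ ⟦ n ⟧
  ⟦⟧-nonneg n = ⟦≤⟧ (ℕ.z≤n {n})

  <+⟦⟧ : ∀ p {n} → 0 ℕ.< n → p < p + ⟦ n ⟧
  <+⟦⟧ p n>0 = subst (_< p + _) (ℚP.+-identityʳ p) (ℚP.+-monoʳ-< p (⟦<⟧ n>0))

  +-minus : ∀ p q → (p + q) - p ≡ q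
  +-minus = solve 2 (λ p q → (p :+ q) :- p := q) refl

  +-cancelʳ-≤ : ∀ {p q} r → p + r ≤ q + r → p ≤ q
  +-cancelʳ-≤ {p} {q} r h = subst₂ _≤_ (undo p) (undo q) (ℚP.+-monoˡ-≤ (- r) h)
    where
    undo : ∀ x → (x + r) + - r ≡ x
    undo x = solve 2 (λ x r → (x :+ r) :+ :- r := x) refl x r

-- Intervals [s, e) are pairs (s , e).  If pairwise non-overlapping intervals
-- each lie inside one of a list of regions, their total length is at most that of the
-- regions.  Induction on the intervals: the first one is cut out of its region, which
-- splits into the parts to its left and right, and the others stay inside the pieces.
module Packing where
  open import Data.Rational using (ℚ; _+_; _-_; -_; _≤_; 0ℚ)
  import Data.Rational.Properties as ℚP
  open import Data.Rational.Solver using (module +-*-Solver)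
  open +-*-Solver using (solve; _:=_; _:+_; _:-_; con)
  open import Data.List using (List; []; _∷_)
  open import Data.List.Relation.Unary.All as All using (All; []; _∷_)
  open import Data.List.Relation.Unary.Any using (Any; here; there)
  open import Data.List.Relation.Unary.AllPairs using (AllPairs; []; _∷_)
  open import Data.Product using (_×_; _,_)
  open import Data.Sum using (_⊎_; inj₁; inj₂)
  open import Relation.Binary.PropositionalEquality

  Interval : Set
  Interval = ℚ × ℚ

  length : Interval → ℚ
  length (s , e) = e - s

  totalLength : List Interval → ℚ
  totalLength []       = 0ℚ
  totalLength (x ∷ xs) = length x + totalLength xs

  _⊑_ : Interval → Interval → Set
  (s , e) ⊑ (a , b) = a ≤ s × e ≤ b

  Apart : Interval → Interval → Set
  Apart (s , e) (s′ , e′) = e ≤ s′ ⊎ e′ ≤ s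

  Proper : Interval → Set
  Proper (a , b) = a ≤ b

  length-nonneg : ∀ {r} → Proper r → 0ℚ ≤ length r
  length-nonneg {a , b} a≤b = subst (_≤ b - a) (ℚP.+-inverseʳ a) (ℚP.+-monoˡ-≤ (- a) a≤b)

  totalLength-nonneg : ∀ {rs} → All Proper rs → 0ℚ ≤ totalLength rs
  totalLength-nonneg []         = ℚP.≤-refl
  totalLength-nonneg (p ∷ ps) = ℚP.+-mono-≤ (length-nonneg p) (totalLength-nonneg ps)

  carve : ∀ x (rs : List Interval) → Any (x ⊑_) rs → List Interval
  carve (s , e) ((a , b) ∷ rs) (here _) = (a , s) ∷ (e , b) ∷ rs
  carve x       (r ∷ rs)       (there p) = r ∷ carve x rs p

  carve-length : ∀ x rs p → totalLength (carve x rs p) + length x ≡ totalLength rs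
  carve-length (s , e) ((a , b) ∷ rs) (here _) =
    solve 5 (λ a s e b t → ((s :- a) :+ ((b :- e) :+ t)) :+ (e :- s) := (b :- a) :+ t)
      refl a s e b (totalLength rs)
  carve-length x (r ∷ rs) (there p) =
    trans (ℚP.+-assoc (length r) _ _) (cong (length r +_) (carve-length x rs p))

  carve-proper : ∀ x rs p → All Proper rs → All Proper (carve x rs p)
  carve-proper x (r ∷ rs) (here (a≤s , e≤b)) (_ ∷ ps) = a≤s ∷ e≤b ∷ ps
  carve-proper x (r ∷ rs) (there p)           (q ∷ ps) = q ∷ carve-proper x rs p ps

  carve-keeps : ∀ x y rs p → Apart x y → Any (y ⊑_) rs → Any (y ⊑_) (carve x rs p)
  carve-keeps (s , e) (s′ , e′) (r ∷ rs) (here _) (inj₁ e≤s′) (here (_ , e′≤b)) =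
    there (here (e≤s′ , e′≤b))
  carve-keeps (s , e) (s′ , e′) (r ∷ rs) (here _) (inj₂ e′≤s) (here (a≤s′ , _)) =
    here (a≤s′ , e′≤s)
  carve-keeps x y (r ∷ rs) (here _)  _ (there q) = there (there q)
  carve-keeps x y (r ∷ rs) (there p) _ (here q)  = here q
  carve-keeps x y (r ∷ rs) (there p) apart (there q) = there (carve-keeps x y rs p apart q)

  packing : ∀ xs rs → All Proper rs → AllPairs Apart xs → All (λ x → Any (x ⊑_) rs) xs →
            totalLength xs ≤ totalLength rs
  packing []       rs proper _                  _             = totalLength-nonneg proper
  packing (x ∷ xs) rs proper (x-apart ∷ apart) (x∈rs ∷ xs∈rs) =
    subst (length x + totalLength xs ≤_)
      (trans (ℚP.+-comm (length x) _) (carve-length x rs x∈rs))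
      (ℚP.+-monoʳ-≤ (length x)
        (packing xs (carve x rs x∈rs) (carve-proper x rs x∈rs proper) apart
          (All.zipWith (λ (x∥y , y∈rs) → carve-keeps x _ rs x∈rs x∥y y∈rs) (x-apart , xs∈rs))))

  fits-in : ∀ {lo hi} xs → lo ≤ hi → AllPairs Apart xs → All (_⊑ (lo , hi)) xs →
            lo + totalLength xs ≤ hi
  fits-in {lo} {hi} xs lo≤hi apart inside =
    subst (lo + totalLength xs ≤_)
      (solve 2 (λ lo hi → lo :+ ((hi :- lo) :+ con 0ℚ) := hi) refl lo hi)
      (ℚP.+-monoʳ-≤ lo (packing xs ((lo , hi) ∷ []) (lo≤hi ∷ []) apart (All.map here inside)))

module WeightedSums where
  open import Data.Nat
  open import Data.Nat.Properties
  open import Data.Nat.Solver using (module +-*-Solver)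
  open +-*-Solver using (solve; _:=_; _:+_; _:*_; con)
  open import Data.Sum using (inj₁; inj₂)
  open import Relation.Binary.PropositionalEquality

  ∑< : ℕ → (ℕ → ℕ) → ℕ
  ∑< zero    f = 0
  ∑< (suc n) f = ∑< n f + f n

  infix 5 ∑<
  syntax ∑< n (λ k → e) = ∑[ k < n ] e

  ∑-cong : ∀ n {f g : ℕ → ℕ} → (∀ k → k < n → f k ≡ g k) → ∑< n f ≡ ∑< n g
  ∑-cong zero    f≡g = refl
  ∑-cong (suc n) f≡g = cong₂ _+_ (∑-cong n (λ k k<n → f≡g k (m<n⇒m<1+n k<n))) (f≡g n ≤-refl)

  ∑-mono : ∀ n {f g : ℕ → ℕ} → (∀ k → k < n → f k ≤ g k) → ∑< n f ≤ ∑< n g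
  ∑-mono zero    f≤g = z≤n
  ∑-mono (suc n) f≤g = +-mono-≤ (∑-mono n (λ k k<n → f≤g k (m<n⇒m<1+n k<n))) (f≤g n ≤-refl)

  ∑-const : ∀ n c → ∑[ k < n ] c ≡ n * c
  ∑-const zero    c = refl
  ∑-const (suc n) c = trans (cong (_+ c) (∑-const n c)) (+-comm (n * c) c)

  ∑-squeeze : ∀ n {f g : ℕ → ℕ} → (∀ k → k < n → f k ≤ g k) → ∑< n g ≤ ∑< n f →
              ∀ k → k < n → f k ≡ g k
  ∑-squeeze (suc n) {f} {g} f≤g Σg≤Σf k k<1+n with m≤n⇒m<n∨m≡n (≤-pred k<1+n)
  ... | inj₁ k<n = ∑-squeeze n f≤g′ Σg≤Σf-below k k<n
    where
    f≤g′ : ∀ k → k < n → f k ≤ g k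
    f≤g′ k k<n = f≤g k (m<n⇒m<1+n k<n)
    Σg≤Σf-below : ∑< n g ≤ ∑< n f
    Σg≤Σf-below = +-cancelʳ-≤ (g n) _ _ (≤-trans Σg≤Σf (+-monoʳ-≤ (∑< n f) (f≤g n ≤-refl)))
  ... | inj₂ refl = ≤-antisym (f≤g n ≤-refl) gn≤fn
    where
    gn≤fn : g n ≤ f n
    gn≤fn = +-cancelˡ-≤ (∑< n g) _ _
              (≤-trans Σg≤Σf (+-monoˡ-≤ (f n) (∑-mono n (λ k k<n → f≤g k (m<n⇒m<1+n k<n)))))

  prefix : (ℕ → ℕ) → ℕ → ℕ
  prefix N n = ∑[ k < n ] N k

  weighted : (ℕ → ℕ) → ℕ → ℕ
  weighted N n = ∑[ k < n ] suc k * N k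

  abel : ∀ N n → weighted N n + (∑[ k < n ] prefix N k) ≡ n * prefix N n
  abel N zero    = refl
  abel N (suc n) = begin
      (weighted N n + suc n * N n) + ((∑[ k < n ] prefix N k) + prefix N n)
    ≡⟨ solve 5 (λ W Σ P x n → (W :+ (con 1 :+ n) :* x) :+ (Σ :+ P) := (W :+ Σ) :+ ((con 1 :+ n) :* x :+ P))
         refl (weighted N n) (∑[ k < n ] prefix N k) (prefix N n) (N n) n ⟩
      (weighted N n + (∑[ k < n ] prefix N k)) + (suc n * N n + prefix N n)
    ≡⟨ cong (_+ (suc n * N n + prefix N n)) (abel N n) ⟩
      n * prefix N n + (suc n * N n + prefix N n)
    ≡⟨ solve 3 (λ P x n → n :* P :+ ((con 1 :+ n) :* x :+ P) := (con 1 :+ n) :* (P :+ x))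
         refl (prefix N n) (N n) n ⟩
      suc n * prefix N (suc n) ∎
    where open ≡-Reasoning

  module Rigidity (m : ℕ) (N M : ℕ → ℕ)
                  (dominated : ∀ K → K ≤ m → weighted N K ≤ weighted M K) where

    prefix-dominated : ∀ K → K ≤ m → ∀ k → k ≤ K → prefix N k ≤ prefix M k
    prefix-dominated zero    _     .zero z≤n = z≤n
    prefix-dominated (suc K) 1+K≤m k k≤1+K with m≤n⇒m<n∨m≡n k≤1+K
    ... | inj₁ k<1+K = prefix-dominated K (≤-trans (n≤1+n K) 1+K≤m) k (≤-pred k<1+K)
    ... | inj₂ refl  = *-cancelˡ-≤ (suc K) (begin
        suc K * prefix N (suc K)                              ≡⟨ abel N (suc K) ⟨
        weighted N (suc K) + (∑[ k < suc K ] prefix N k)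
          ≤⟨ +-mono-≤ (dominated (suc K) 1+K≤m)
                      (∑-mono (suc K) (λ j j<1+K → prefix-dominated K (≤-trans (n≤1+n K) 1+K≤m) j (≤-pred j<1+K))) ⟩
        weighted M (suc K) + (∑[ k < suc K ] prefix M k)        ≡⟨ abel M (suc K) ⟩
        suc K * prefix M (suc K)                              ∎)
      where open ≤-Reasoning

    module _ (total : prefix N m ≡ prefix M m) where

      prefix-totals : ∑[ k < m ] prefix M k ≤ ∑[ k < m ] prefix N k
      prefix-totals = +-cancelˡ-≤ (weighted M m) _ _ (begin
        weighted M m + (∑[ k < m ] prefix M k)  ≡⟨ abel M m ⟩
        m * prefix M m                         ≡⟨ cong (m *_) total ⟨
        m * prefix N m                         ≡⟨ abel N m ⟨
        weighted N m + (∑[ k < m ] prefix N k)  ≤⟨ +-monoˡ-≤ _ (dominated m ≤-refl) ⟩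
        weighted M m + (∑[ k < m ] prefix N k)  ∎)
        where open ≤-Reasoning

      prefixes-agree : ∀ k → k ≤ m → prefix N k ≡ prefix M k
      prefixes-agree k k≤m with m≤n⇒m<n∨m≡n k≤m
      ... | inj₁ k<m  = ∑-squeeze m (λ j j<m → prefix-dominated m ≤-refl j (<⇒≤ j<m)) prefix-totals k k<m
      ... | inj₂ refl = total

      rigidity : ∀ k → k < m → N k ≡ M k
      rigidity k k<m = +-cancelˡ-≡ (prefix N k) _ _ (begin
        prefix N (suc k)   ≡⟨ prefixes-agree (suc k) k<m ⟩
        prefix M (suc k)   ≡⟨ cong (_+ M k) (prefixes-agree k (<⇒≤ k<m)) ⟨
        prefix N k + M k   ∎)
        where open ≡-Reasoning

module ListSums where
  open import Data.Nat using (ℕ; _+_; _*_)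
  open import Data.Nat.ListAction using (sum)
  open import Data.Nat.ListAction.Properties using (sum-++)
  open import Data.List using (List; []; _∷_; map; filter; _++_; length)
  open import Data.List.Properties using (map-++; map-∘; filter-accept; filter-reject)
  open import Level using (0ℓ)
  open import Function using (_∘_)
  open import Relation.Unary using (Pred; Decidable)
  open import Relation.Nullary using (¬_)
  open import Relation.Binary.PropositionalEquality

  private variable A B : Set

  Σ[_]_ : (A → ℕ) → List A → ℕ
  Σ[ f ] xs = sum (map f xs)

  Σ-++ : ∀ (f : A → ℕ) xs ys → Σ[ f ] (xs ++ ys) ≡ Σ[ f ] xs + Σ[ f ] ys
  Σ-++ f xs ys = trans (cong sum (map-++ f xs ys)) (sum-++ (map f xs) (map f ys))

  Σ-map : ∀ (f : A → ℕ) (g : B → A) xs → Σ[ f ] map g xs ≡ Σ[ f ∘ g ] xs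
  Σ-map f g xs = cong sum (sym (map-∘ xs))

  Σ-const : ∀ c (xs : List A) → Σ[ (λ _ → c) ] xs ≡ length xs * c
  Σ-const c []       = refl
  Σ-const c (x ∷ xs) = cong (c +_) (Σ-const c xs)

  Σ-keep : ∀ (f : A → ℕ) {P : Pred A 0ℓ} (P? : Decidable P) {x} xs → P x →
           Σ[ f ] filter P? (x ∷ xs) ≡ f x + Σ[ f ] filter P? xs
  Σ-keep f P? xs px = cong Σ[ f ]_ (filter-accept P? px)

  Σ-skip : ∀ (f : A → ℕ) {P : Pred A 0ℓ} (P? : Decidable P) {x} xs → ¬ P x →
           Σ[ f ] filter P? (x ∷ xs) ≡ Σ[ f ] filter P? xs
  Σ-skip f P? xs ¬px = cong Σ[ f ]_ (filter-reject P? ¬px)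

module LevelSums {A : Set} (level : A → ℕ) where
  open import Data.Nat
  open import Data.Nat.Properties
  open import Data.List using (List; []; _∷_; map; filter)
  open import Data.List.Properties using (filter-none)
  import Data.List.Relation.Unary.All as All
  open import Function using (_∘_)
  open import Relation.Nullary using (yes; no)
  open import Algebra.Properties.CommutativeSemigroup +-commutativeSemigroup using (x∙yz≈y∙xz)
  open import Relation.Binary using (tri<; tri≈; tri>)
  open import Relation.Binary.PropositionalEquality
  open ≡-Reasoning
  open WeightedSums
  open ListSums

  below : ℕ → List A → List A
  below K = filter (λ x → level x <? K)

  at : ℕ → List A → List A
  at k = filter (λ x → level x ≟ k)

  Σ-below-suc : ∀ f K xs → Σ[ f ] below (suc K) xs ≡ Σ[ f ] below K xs + Σ[ f ] at K xs
  Σ-below-suc f K [] = refl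
  Σ-below-suc f K (x ∷ xs) with <-cmp (level x) K
  ... | tri< lt ¬eq _ = begin
      Σ[ f ] below (suc K) (x ∷ xs)                  ≡⟨ Σ-keep f _ xs (m<n⇒m<1+n lt) ⟩
      f x + Σ[ f ] below (suc K) xs                  ≡⟨ cong (f x +_) (Σ-below-suc f K xs) ⟩
      f x + (Σ[ f ] below K xs + Σ[ f ] at K xs)      ≡⟨ +-assoc (f x) _ _ ⟨
      (f x + Σ[ f ] below K xs) + Σ[ f ] at K xs      ≡⟨ cong₂ _+_ (Σ-keep f _ xs lt) (Σ-skip f _ xs ¬eq) ⟨
      Σ[ f ] below K (x ∷ xs) + Σ[ f ] at K (x ∷ xs)  ∎
  ... | tri≈ ¬lt eq _ = begin
      Σ[ f ] below (suc K) (x ∷ xs)                  ≡⟨ Σ-keep f _ xs (s≤s (≤-reflexive eq)) ⟩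
      f x + Σ[ f ] below (suc K) xs                  ≡⟨ cong (f x +_) (Σ-below-suc f K xs) ⟩
      f x + (Σ[ f ] below K xs + Σ[ f ] at K xs)      ≡⟨ x∙yz≈y∙xz (f x) (Σ[ f ] below K xs) (Σ[ f ] at K xs) ⟩
      Σ[ f ] below K xs + (f x + Σ[ f ] at K xs)      ≡⟨ cong₂ _+_ (Σ-skip f _ xs ¬lt) (Σ-keep f _ xs eq) ⟨
      Σ[ f ] below K (x ∷ xs) + Σ[ f ] at K (x ∷ xs)  ∎
  ... | tri> ¬lt ¬eq gt = begin
      Σ[ f ] below (suc K) (x ∷ xs)                  ≡⟨ Σ-skip f _ xs (<⇒≱ gt ∘ ≤-pred) ⟩
      Σ[ f ] below (suc K) xs                        ≡⟨ Σ-below-suc f K xs ⟩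
      Σ[ f ] below K xs + Σ[ f ] at K xs              ≡⟨ cong₂ _+_ (Σ-skip f _ xs ¬lt) (Σ-skip f _ xs ¬eq) ⟨
      Σ[ f ] below K (x ∷ xs) + Σ[ f ] at K (x ∷ xs)  ∎

  Σ-by-level : ∀ f K xs → Σ[ f ] below K xs ≡ ∑[ k < K ] Σ[ f ] at k xs
  Σ-by-level f zero    xs = cong Σ[ f ]_ (filter-none _ (All.universal (λ _ ()) xs))
  Σ-by-level f (suc K) xs = trans (Σ-below-suc f K xs) (cong (_+ Σ[ f ] at K xs) (Σ-by-level f K xs))

  Σ-at-scaled : ∀ f k xs → Σ[ (λ x → suc (level x) * f x) ] at k xs ≡ suc k * Σ[ f ] at k xs
  Σ-at-scaled f k [] = sym (*-zeroʳ (suc k))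
  Σ-at-scaled f k (x ∷ xs) with level x ≟ k
  ... | yes refl = begin
      Σ[ g ] at k (x ∷ xs)             ≡⟨ Σ-keep g _ xs refl ⟩
      suc k * f x + Σ[ g ] at k xs     ≡⟨ cong (suc k * f x +_) (Σ-at-scaled f k xs) ⟩
      suc k * f x + suc k * Σ[ f ] at k xs  ≡⟨ *-distribˡ-+ (suc k) (f x) _ ⟨
      suc k * (f x + Σ[ f ] at k xs)   ≡⟨ cong (suc k *_) (Σ-keep f _ xs refl) ⟨
      suc k * Σ[ f ] at k (x ∷ xs)     ∎
    where g = λ x → suc (level x) * f x
  ... | no ¬eq = begin
      Σ[ g ] at k (x ∷ xs)             ≡⟨ Σ-skip g _ xs ¬eq ⟩
      Σ[ g ] at k xs                   ≡⟨ Σ-at-scaled f k xs ⟩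
      suc k * Σ[ f ] at k xs           ≡⟨ cong (suc k *_) (Σ-skip f _ xs ¬eq) ⟨
      suc k * Σ[ f ] at k (x ∷ xs)     ∎
    where g = λ x → suc (level x) * f x

module Windows (B : ℕ) where
  open import Defs using (lℕ; Lℕ)
  open import Data.Nat
  open import Data.Nat.Properties
  open import Data.Nat.DivMod using (_/_; m*n/n≡m; +-distrib-/-∣ʳ)
  open import Data.Nat.Divisibility using (divides-refl)
  open import Data.Nat.Solver using (module +-*-Solver)
  open +-*-Solver using (solve; _:=_; _:+_; _:*_; con)
  open import Relation.Binary.PropositionalEquality
  open WeightedSums

  triangle-suc : ∀ k → (suc k * suc (suc k)) / 2 ≡ (k * suc k) / 2 + suc k
  triangle-suc k = begin
      (suc k * suc (suc k)) / 2        ≡⟨ cong (_/ 2) expand ⟩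
      (k * suc k + suc k * 2) / 2      ≡⟨ +-distrib-/-∣ʳ (k * suc k) (divides-refl (suc k)) ⟩
      (k * suc k) / 2 + suc k * 2 / 2  ≡⟨ cong ((k * suc k) / 2 +_) (m*n/n≡m (suc k) 2) ⟩
      (k * suc k) / 2 + suc k          ∎
    where
    open ≡-Reasoning
    expand : suc k * suc (suc k) ≡ k * suc k + suc k * 2
    expand = solve 1 (λ k → (con 1 :+ k) :* (con 2 :+ k) := k :* (con 1 :+ k) :+ (con 1 :+ k) :* con 2) refl k

  l-step : ∀ k → lℕ B (suc k) ≡ lℕ B k + B ^ 3 + suc k * B
  l-step k = begin
      suc k * B ^ 3 + (suc k * suc (suc k)) / 2 * B   ≡⟨ cong (λ t → suc k * B ^ 3 + t * B) (triangle-suc k) ⟩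
      suc k * B ^ 3 + ((k * suc k) / 2 + suc k) * B   ≡⟨ solve 4 (λ k X t B → (con 1 :+ k) :* X :+ (t :+ (con 1 :+ k)) :* B
                                                                 := k :* X :+ t :* B :+ X :+ (con 1 :+ k) :* B)
                                                         refl k (B ^ 3) ((k * suc k) / 2) B ⟩
      lℕ B k + B ^ 3 + suc k * B                      ∎
    where open ≡-Reasoning

  l-closed : ∀ K → lℕ B K ≡ K * B ^ 3 + weighted (λ _ → B) K
  l-closed zero    = refl
  l-closed (suc K) = begin
      lℕ B (suc K)                                         ≡⟨ l-step K ⟩
      lℕ B K + B ^ 3 + suc K * B                           ≡⟨ cong (λ l → l + B ^ 3 + suc K * B) (l-closed K) ⟩
      K * B ^ 3 + weighted (λ _ → B) K + B ^ 3 + suc K * B ≡⟨ solve 4 (λ K X W Y → K :* X :+ W :+ X :+ Y := (con 1 :+ K) :* X :+ (W :+ Y))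
                                                                refl K (B ^ 3) (weighted (λ _ → B) K) (suc K * B) ⟩
      suc K * B ^ 3 + weighted (λ _ → B) (suc K)           ∎
    where open ≡-Reasoning

  l-grows : ∀ k → lℕ B k + B ^ 3 ≤ lℕ B (suc k)
  l-grows k = subst (lℕ B k + B ^ 3 ≤_) (sym (l-step k)) (m≤m+n _ _)

  l-mono : ∀ {j k} → j ≤ k → lℕ B j ≤ lℕ B k
  l-mono j≤k = go (≤⇒≤′ j≤k)
    where
    go : ∀ {j k} → j ≤′ k → lℕ B j ≤ lℕ B k
    go ≤′-refl              = ≤-refl
    go (≤′-step {k} j≤′k) = ≤-trans (go j≤′k) (≤-trans (m≤m+n _ _) (l-grows k))

  l-below-cube : ∀ {K} → K < B → lℕ B K < suc K * B ^ 3
  l-below-cube {K} K<B = begin-strict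
      lℕ B K                         ≡⟨ l-closed K ⟩
      K * B ^ 3 + weighted (λ _ → B) K ≤⟨ +-monoʳ-≤ (K * B ^ 3) (∑-mono K (λ k k<K → *-monoˡ-≤ B k<K)) ⟩
      K * B ^ 3 + (∑[ k < K ] K * B)   ≡⟨ cong (K * B ^ 3 +_) (∑-const K (K * B)) ⟩
      K * B ^ 3 + K * (K * B)          <⟨ +-monoʳ-< (K * B ^ 3) (*-mono-< K<B (*-monoˡ-< B {{>-nonZero B>0}} K<B)) ⟩
      K * B ^ 3 + B * (B * B)          ≡⟨ cong (λ c → K * B ^ 3 + B * (B * c)) (*-identityʳ B) ⟨
      K * B ^ 3 + B ^ 3                ≡⟨ +-comm (K * B ^ 3) (B ^ 3) ⟩
      suc K * B ^ 3                    ∎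
    where
    open ≤-Reasoning
    B>0 : 0 < B
    B>0 = ≤-<-trans z≤n K<B

  L≡l : ∀ m → Lℕ B m ≡ lℕ B m
  L≡l m = cong (m * B ^ 3 +_) (*-comm B _)

module WindowGaps (B : ℕ) where
  open import Defs using (⟦_⟧; lℕ)
  open import Data.Nat as ℕ using (suc; _^_)
  open import Data.Rational using (_+_; _-_)
  open import Data.Rational.Solver using (module +-*-Solver)
  open +-*-Solver using (solve; _:=_; _:+_; _:-_)
  open import Relation.Binary.PropositionalEquality
  open Embedding
  open Windows B using (l-step)

  window-gap : ∀ k → ⟦ lℕ B (suc k) ⟧ - (⟦ lℕ B k ⟧ + ⟦ B ^ 3 ⟧) ≡ ⟦ suc k ℕ.* B ⟧
  window-gap k = begin
      ⟦ lℕ B (suc k) ⟧ - (⟦ lℕ B k ⟧ + ⟦ B ^ 3 ⟧)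
    ≡⟨ cong (_- (⟦ lℕ B k ⟧ + ⟦ B ^ 3 ⟧)) l-split ⟩
      (⟦ lℕ B k ⟧ + ⟦ B ^ 3 ⟧ + ⟦ suc k ℕ.* B ⟧) - (⟦ lℕ B k ⟧ + ⟦ B ^ 3 ⟧)
    ≡⟨ solve 3 (λ l c g → (l :+ c :+ g) :- (l :+ c) := g) refl ⟦ lℕ B k ⟧ ⟦ B ^ 3 ⟧ ⟦ suc k ℕ.* B ⟧ ⟩
      ⟦ suc k ℕ.* B ⟧ ∎
    where
    open ≡-Reasoning
    l-split : ⟦ lℕ B (suc k) ⟧ ≡ ⟦ lℕ B k ⟧ + ⟦ B ^ 3 ⟧ + ⟦ suc k ℕ.* B ⟧
    l-split = begin
      ⟦ lℕ B (suc k) ⟧                                    ≡⟨ cong ⟦_⟧ (l-step k) ⟩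
      ⟦ lℕ B k ℕ.+ B ^ 3 ℕ.+ suc k ℕ.* B ⟧                ≡⟨ ⟦+⟧ (lℕ B k ℕ.+ B ^ 3) (suc k ℕ.* B) ⟩
      ⟦ lℕ B k ℕ.+ B ^ 3 ⟧ + ⟦ suc k ℕ.* B ⟧              ≡⟨ cong (_+ ⟦ suc k ℕ.* B ⟧) (⟦+⟧ (lℕ B k) (B ^ 3)) ⟩
      ⟦ lℕ B k ⟧ + ⟦ B ^ 3 ⟧ + ⟦ suc k ℕ.* B ⟧            ∎

-- Tasks are indexed from 0: the J-task j starts in
-- the window I_{κ j + 1} = [l_{κ j}, l_{κ j + 1}), and J̃-task i (toℕ i) is the one of the
-- paper with index i + 1.  The level of a task is κ j, resp. toℕ i.
module Analysis (B m : ℕ) (m<B : m ℕ.< B) (a : Fin (3 ℕ.* m) → ℕ) (a>0 : ∀ j → 0 ℕ.< a j)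
                (a-total : sum (tabulate a) ≡ m ℕ.* B) (D : FeasibleSchedule B m a) where
  open import Defs
  open import Data.Nat using (zero; suc; _^_; z≤n; s≤s; _<?_)
  import Data.Nat.Properties as ℕP
  open import Data.Rational using (ℚ; _+_; _-_; _≤_; _<_; 0ℚ)
  import Data.Rational.Properties as ℚP
  open import Data.Fin using (toℕ; fromℕ<; inject≤)
  open import Data.Fin.Properties using (toℕ<n; toℕ-fromℕ<; fromℕ<-toℕ; toℕ-inject≤; inject≤-injective)
  open import Data.List using (List; []; _∷_; map; _++_; allFin)
  open import Data.List.Properties using (length-tabulate; map-tabulate; filter-all)
  open import Data.List.Membership.Propositional using (_∈_)
  open import Data.List.Membership.Propositional.Properties using (∈-map⁻)
  open import Data.List.Relation.Unary.All as All using (All)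
  import Data.List.Relation.Unary.All.Properties as All
  import Data.List.Relation.Unary.AllPairs as AllPairs
  import Data.List.Relation.Unary.AllPairs.Properties as AllPairs
  open import Data.List.Relation.Unary.Unique.Propositional using (Unique)
  import Data.List.Relation.Unary.Unique.Propositional.Properties as Unique
  open import Data.Product using (_,_; proj₁; proj₂)
  open import Data.Sum using (inj₁; inj₂)
  open import Data.Sum.Properties using (inj₁-injective; inj₂-injective)
  open import Data.Empty using (⊥; ⊥-elim)
  open import Function using (_∘_)
  open import Relation.Nullary using (yes; no)
  open import Relation.Binary.PropositionalEquality
  open FeasibleSchedule D
  open Embedding
  open Packing
  open WeightedSums
  open ListSums
  open Windows B

  B³ : ℕ
  B³ = B ^ 3

  κ : Fin (3 ℕ.* m) → ℕ
  κ j = proj₁ (comp-J j)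

  κ<m : ∀ j → κ j ℕ.< m
  κ<m j = proj₁ (proj₂ (comp-J j))

  start-in-window : ∀ j → InI B (κ j) (start (inj₁ j))
  start-in-window j = proj₁ (proj₂ (proj₂ (comp-J j)))

  level : Task m → ℕ
  level (inj₁ j) = κ j
  level (inj₂ i) = toℕ i

  dur : Task m → ℕ
  dur (inj₁ j) = suc (κ j) ℕ.* a j
  dur (inj₂ _) = B³

  comp≡start+dur : ∀ x → comp x ≡ start x + ⟦ dur x ⟧
  comp≡start+dur (inj₁ j) = proj₂ (proj₂ (proj₂ (comp-J j)))
  comp≡start+dur (inj₂ i) = comp-J̃ i

  dur>0 : ∀ x → 0 ℕ.< dur x
  dur>0 (inj₁ j) = ℕP.<-≤-trans (a>0 j) (ℕP.m≤m+n (a j) _)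
  dur>0 (inj₂ i) = ℕP.m^n>0 B {{ℕ.>-nonZero (ℕP.≤-<-trans z≤n m<B)}} 3

  start<comp : ∀ x → start x < comp x
  start<comp x = subst (start x <_) (sym (comp≡start+dur x)) (<+⟦⟧ (start x) (dur>0 x))

  span : Task m → Interval
  span x = start x , comp x

  distinct⇒apart : ∀ x y → x ≢ y → Apart (span x) (span y)
  distinct⇒apart x y x≢y with ℚP.≤-total (start x) (start y)
  ... | inj₁ sx≤sy with comp x ℚP.≤? start y
  ...   | yes cx≤sy = inj₁ cx≤sy
  ...   | no  cx≰sy = ⊥-elim (disjoint x y x≢y (start y) sx≤sy (ℚP.≰⇒> cx≰sy) ℚP.≤-refl (start<comp y))
  distinct⇒apart x y x≢y | inj₂ sy≤sx with comp y ℚP.≤? start x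
  ...   | yes cy≤sx = inj₂ cy≤sx
  ...   | no  cy≰sx = ⊥-elim (disjoint x y x≢y (start x) ℚP.≤-refl (start<comp x) sy≤sx (ℚP.≰⇒> cy≰sx))

  distinct-levels : ∀ {x y} → level x ≢ level y → x ≢ y
  distinct-levels ne eq = ne (cong level eq)

  J̃-start≤l : ∀ i → start (inj₂ i) ≤ ⟦ lℕ B (toℕ i) ⟧
  J̃-start≤l i = +-cancelʳ-≤ ⟦ B³ ⟧ (subst₂ _≤_ (comp-J̃ i) (⟦+⟧ (lℕ B (toℕ i)) B³) (deadline-J̃ i))

  -- J̃_i starts before (i+1)·B³, since l_i < (i+1)·B³ as i < m < B
  J̃-early : ∀ i → start (inj₂ i) < ⟦ suc (toℕ i) ℕ.* B³ ⟧
  J̃-early i = ℚP.≤-<-trans (J̃-start≤l i) (⟦<⟧ (l-below-cube (ℕP.<-trans (toℕ<n i) m<B)))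

  -- every task starts before (level + 2)·B³: J_j starts before l_{κ j + 1} < (κ j + 2)·B³
  early : ∀ x → start x < ⟦ suc (suc (level x)) ℕ.* B³ ⟧
  early (inj₁ j) = ℚP.<-trans (proj₂ (start-in-window j)) (⟦<⟧ (l-below-cube (ℕP.≤-<-trans (κ<m j) m<B)))
  early (inj₂ i) = ℚP.<-≤-trans (J̃-early i) (⟦≤⟧ (ℕP.*-monoˡ-≤ B³ (ℕP.n≤1+n (suc (toℕ i)))))

  J̃-shift : ∀ K i → ⟦ K ℕ.* B³ ⟧ ≤ start (inj₂ i) → ⟦ suc K ℕ.* B³ ⟧ ≤ comp (inj₂ i)
  J̃-shift K i K≤s = begin
      ⟦ suc K ℕ.* B³ ⟧          ≡⟨ cong ⟦_⟧ (ℕP.+-comm B³ (K ℕ.* B³)) ⟩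
      ⟦ K ℕ.* B³ ℕ.+ B³ ⟧       ≡⟨ ⟦+⟧ (K ℕ.* B³) B³ ⟩
      ⟦ K ℕ.* B³ ⟧ + ⟦ B³ ⟧     ≤⟨ ℚP.+-monoˡ-≤ ⟦ B³ ⟧ K≤s ⟩
      start (inj₂ i) + ⟦ B³ ⟧   ≡⟨ comp-J̃ i ⟨
      comp (inj₂ i)             ∎
    where open ℚP.≤-Reasoning hiding (start)

  -- J̃_i starts no earlier than K·B³ for every K ≤ i.  Induction on K: J̃_K precedes J̃_i,
  -- since otherwise J̃_K would start after J̃_i completes, i.e. after (K+1)·B³.
  J̃-late : ∀ K (i : Fin m) → K ℕ.≤ toℕ i → ⟦ K ℕ.* B³ ⟧ ≤ start (inj₂ i)
  J̃-late zero    i _   = start-nonneg (inj₂ i)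
  J̃-late (suc K) i K<i = by-order (distinct⇒apart (inj₂ k) (inj₂ i) (distinct-levels (ℕP.<⇒≢ k<i)))
    where
    open ℚP.≤-Reasoning hiding (start)
    K<m = ℕP.<-trans K<i (toℕ<n i)
    k = fromℕ< K<m
    toℕ-k : toℕ k ≡ K
    toℕ-k = toℕ-fromℕ< K<m
    k<i : toℕ k ℕ.< toℕ i
    k<i = subst (ℕ._< toℕ i) (sym toℕ-k) K<i
    by-order : Apart (span (inj₂ k)) (span (inj₂ i)) → ⟦ suc K ℕ.* B³ ⟧ ≤ start (inj₂ i)
    by-order (inj₁ k-before-i) = ℚP.≤-trans (J̃-shift K k (J̃-late K k (ℕP.≤-reflexive (sym toℕ-k)))) k-before-i
    by-order (inj₂ i-before-k) = ⊥-elim (ℚP.<-irrefl refl (begin-strict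
      ⟦ suc K ℕ.* B³ ⟧            ≤⟨ J̃-shift K i (J̃-late K i (ℕP.<⇒≤ K<i)) ⟩
      comp (inj₂ i)               ≤⟨ i-before-k ⟩
      start (inj₂ k)              <⟨ J̃-early k ⟩
      ⟦ suc (toℕ k) ℕ.* B³ ⟧      ≡⟨ cong (λ n → ⟦ suc n ℕ.* B³ ⟧) toℕ-k ⟩
      ⟦ suc K ℕ.* B³ ⟧            ∎))

  -- The fence S_K: the start of J̃_K for K < m, and L for K = m.  Ĩ_{i+1} = [comp J̃_i, S_{i+1}).
  fence : ℕ → ℚ
  fence K with K <? m
  ... | yes K<m = start (inj₂ (fromℕ< K<m))
  ... | no  _   = ⟦ Lℕ B m ⟧

  fence-J̃ : ∀ i → fence (toℕ i) ≡ start (inj₂ i)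
  fence-J̃ i with toℕ i <? m
  ... | yes i<m = cong (start ∘ inj₂) (fromℕ<-toℕ i i<m)
  ... | no  i≮m = ⊥-elim (i≮m (toℕ<n i))

  fence-end : fence m ≡ ⟦ Lℕ B m ⟧
  fence-end with m <? m
  ... | yes m<m = ⊥-elim (ℕP.<-irrefl refl m<m)
  ... | no  _   = refl

  gapEnd≡fence : ∀ i → gapEnd B m (start ∘ inj₂) i ≡ fence (suc (toℕ i))
  gapEnd≡fence i with suc (toℕ i) <? m
  ... | yes _ = refl
  ... | no  _ = refl

  data FencePost : ℕ → Set where
    at-J̃  : (i : Fin m) → FencePost (toℕ i)
    at-end : FencePost m

  fence-post : ∀ {K} → K ℕ.≤ m → FencePost K
  fence-post K≤m with ℕP.m≤n⇒m<n∨m≡n K≤m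
  ... | inj₁ K<m  = subst FencePost (toℕ-fromℕ< K<m) (at-J̃ (fromℕ< K<m))
  ... | inj₂ refl = at-end

  fence-nonneg : ∀ {K} → FencePost K → 0ℚ ≤ fence K
  fence-nonneg (at-J̃ i) = subst (0ℚ ≤_) (sym (fence-J̃ i)) (start-nonneg (inj₂ i))
  fence-nonneg at-end   = subst (0ℚ ≤_) (sym fence-end) (⟦⟧-nonneg (Lℕ B m))

  fence≤l : ∀ {K} → FencePost K → fence K ≤ ⟦ lℕ B K ⟧
  fence≤l (at-J̃ i) = subst (_≤ ⟦ lℕ B (toℕ i) ⟧) (sym (fence-J̃ i)) (J̃-start≤l i)
  fence≤l at-end   = ℚP.≤-reflexive (trans fence-end (cong ⟦_⟧ (L≡l m)))

  -- every task of level below K completes by the fence S_K: a task of level < K cannot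
  -- follow J̃_K, which completes at time ≥ (K+1)·B³ (J̃-late), because it starts before
  -- (level + 2)·B³ (early); at K = m the deadlines give the bound L
  completes-by-fence : ∀ {K} → FencePost K → ∀ x → level x ℕ.< K → comp x ≤ fence K
  completes-by-fence (at-J̃ k) x x<k with distinct⇒apart x (inj₂ k) (distinct-levels (ℕP.<⇒≢ x<k))
  ... | inj₁ x-before-k = subst (comp x ≤_) (sym (fence-J̃ k)) x-before-k
  ... | inj₂ k-before-x = ⊥-elim (ℚP.<-irrefl refl (begin-strict
      ⟦ suc (suc (level x)) ℕ.* B³ ⟧  ≤⟨ ⟦≤⟧ (ℕP.*-monoˡ-≤ B³ (s≤s x<k)) ⟩
      ⟦ suc (toℕ k) ℕ.* B³ ⟧          ≤⟨ J̃-shift (toℕ k) k (J̃-late (toℕ k) k ℕP.≤-refl) ⟩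
      comp (inj₂ k)                   ≤⟨ k-before-x ⟩
      start x                         <⟨ early x ⟩
      ⟦ suc (suc (level x)) ℕ.* B³ ⟧  ∎))
    where open ℚP.≤-Reasoning hiding (start)
  completes-by-fence at-end (inj₁ j) _ = subst (comp (inj₁ j) ≤_) (sym fence-end) (deadline-J j)
  completes-by-fence at-end (inj₂ i) _ = begin
      comp (inj₂ i)                     ≤⟨ deadline-J̃ i ⟩
      ⟦ lℕ B (toℕ i) ℕ.+ B³ ⟧           ≤⟨ ⟦≤⟧ (ℕP.≤-trans (l-grows (toℕ i)) (l-mono (toℕ<n i))) ⟩
      ⟦ lℕ B m ⟧                        ≡⟨ cong ⟦_⟧ (L≡l m) ⟨
      ⟦ Lℕ B m ⟧                        ≡⟨ fence-end ⟨
      fence m                           ∎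
    where open ℚP.≤-Reasoning hiding (start)

  jobs : List (Fin (3 ℕ.* m))
  jobs = allFin (3 ℕ.* m)

  open LevelSums κ using (below; at; Σ-by-level; Σ-at-scaled)

  N : ℕ → ℕ
  N k = Σ[ a ] at k jobs

  tasksBelow : ∀ {K} → K ℕ.≤ m → List (Task m)
  tasksBelow {K} K≤m = map inj₂ (tabulate {n = K} (λ k → inject≤ k K≤m)) ++ map inj₁ (below K jobs)

  J̃s-disjoint-Js : ∀ {v : Task m} {is js} → v ∈ map inj₂ is → v ∈ map inj₁ js → ⊥
  J̃s-disjoint-Js v∈J̃s v∈Js with ∈-map⁻ inj₂ v∈J̃s | ∈-map⁻ inj₁ v∈Js
  ... | _ , _ , refl | _ , _ , ()

  tasksBelow-unique : ∀ {K} (K≤m : K ℕ.≤ m) → Unique (tasksBelow K≤m)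
  tasksBelow-unique K≤m =
    Unique.++⁺ (Unique.map⁺ inj₂-injective (Unique.tabulate⁺ (inject≤-injective K≤m K≤m _ _)))
               (Unique.map⁺ inj₁-injective (Unique.filter⁺ _ (Unique.allFin⁺ _)))
               (λ (v∈J̃s , v∈Js) → J̃s-disjoint-Js v∈J̃s v∈Js)

  tasksBelow-level : ∀ {K} (K≤m : K ℕ.≤ m) → All (λ x → level x ℕ.< K) (tasksBelow K≤m)
  tasksBelow-level {K} K≤m =
    All.++⁺ (All.map⁺ (All.tabulate⁺ (λ k → subst (ℕ._< K) (sym (toℕ-inject≤ k K≤m)) (toℕ<n k))))
            (All.map⁺ (All.all-filter _ jobs))

  tasksBelow-work : ∀ {K} (K≤m : K ℕ.≤ m) → Σ[ dur ] tasksBelow K≤m ≡ K ℕ.* B³ ℕ.+ weighted N K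
  tasksBelow-work {K} K≤m = begin
      Σ[ dur ] tasksBelow K≤m
    ≡⟨ Σ-++ dur (map inj₂ J̃s) (map inj₁ (below K jobs)) ⟩
      Σ[ dur ] map inj₂ J̃s ℕ.+ Σ[ dur ] map inj₁ (below K jobs)
    ≡⟨ cong₂ ℕ._+_ (Σ-map dur inj₂ J̃s) (Σ-map dur inj₁ (below K jobs)) ⟩
      Σ[ (λ _ → B³) ] J̃s ℕ.+ Σ[ dur ∘ inj₁ ] below K jobs
    ≡⟨ cong₂ ℕ._+_ J̃s-work (Σ-by-level (dur ∘ inj₁) K jobs) ⟩
      K ℕ.* B³ ℕ.+ (∑[ k < K ] Σ[ dur ∘ inj₁ ] at k jobs)
    ≡⟨ cong (K ℕ.* B³ ℕ.+_) (∑-cong K (λ k _ → Σ-at-scaled a k jobs)) ⟩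
      K ℕ.* B³ ℕ.+ weighted N K
    ∎
    where
    open ≡-Reasoning
    J̃s = tabulate {n = K} (λ k → inject≤ k K≤m)
    J̃s-work : Σ[ (λ _ → B³) ] J̃s ≡ K ℕ.* B³
    J̃s-work = trans (Σ-const B³ J̃s) (cong (ℕ._* B³) (length-tabulate (λ k → inject≤ k K≤m)))

  spans-length : ∀ xs → totalLength (map span xs) ≡ ⟦ Σ[ dur ] xs ⟧
  spans-length []       = refl
  spans-length (x ∷ xs) = begin
      (comp x - start x) + totalLength (map span xs)   ≡⟨ cong₂ _+_ span-len (spans-length xs) ⟩
      ⟦ dur x ⟧ + ⟦ Σ[ dur ] xs ⟧                      ≡⟨ ⟦+⟧ (dur x) _ ⟨
      ⟦ dur x ℕ.+ Σ[ dur ] xs ⟧                        ∎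
    where
    open ≡-Reasoning
    span-len : comp x - start x ≡ ⟦ dur x ⟧
    span-len = trans (cong (_- start x) (comp≡start+dur x)) (+-minus (start x) ⟦ dur x ⟧)

  work-fits : ∀ {K} (K≤m : K ℕ.≤ m) → ⟦ K ℕ.* B³ ℕ.+ weighted N K ⟧ ≤ fence K
  work-fits {K} K≤m = subst (_≤ fence K) total
    (fits-in (map span (tasksBelow K≤m)) (fence-nonneg post)
      (AllPairs.map⁺ (AllPairs.map (λ {x} {y} → distinct⇒apart x y) (tasksBelow-unique K≤m)))
      (All.map⁺ (All.map (λ {x} x<K → start-nonneg x , completes-by-fence post x x<K) (tasksBelow-level K≤m))))
    where
    post = fence-post K≤m
    total : 0ℚ + totalLength (map span (tasksBelow K≤m)) ≡ ⟦ K ℕ.* B³ ℕ.+ weighted N K ⟧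
    total = trans (ℚP.+-identityˡ _) (trans (spans-length (tasksBelow K≤m)) (cong ⟦_⟧ (tasksBelow-work K≤m)))

  work-bound : ∀ {K} → K ℕ.≤ m → weighted N K ℕ.≤ weighted (λ _ → B) K
  work-bound {K} K≤m = ℕP.+-cancelˡ-≤ (K ℕ.* B³) _ _ (⟦≤⟧⁻ (begin
      ⟦ K ℕ.* B³ ℕ.+ weighted N K ⟧            ≤⟨ work-fits K≤m ⟩
      fence K                                  ≤⟨ fence≤l (fence-post K≤m) ⟩
      ⟦ lℕ B K ⟧                               ≡⟨ cong ⟦_⟧ (l-closed K) ⟩
      ⟦ K ℕ.* B³ ℕ.+ weighted (λ _ → B) K ⟧    ∎))
    where open ℚP.≤-Reasoning

  -- every J-task starts in some window, so the loads add up to Σ a_j = m·B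
  total-load : prefix N m ≡ prefix (λ _ → B) m
  total-load = begin
      prefix N m                ≡⟨ Σ-by-level a m jobs ⟨
      Σ[ a ] below m jobs       ≡⟨ cong Σ[ a ]_ (filter-all _ (All.tabulate⁺ κ<m)) ⟩
      Σ[ a ] jobs               ≡⟨ cong sum (map-tabulate (λ j → j) a) ⟩
      sum (tabulate a)          ≡⟨ a-total ⟩
      m ℕ.* B                   ≡⟨ ∑-const m B ⟨
      prefix (λ _ → B) m        ∎
    where open ≡-Reasoning

  loads-exact : ∀ k → k ℕ.< m → N k ≡ B
  loads-exact = Rigidity.rigidity m N (λ _ → B) (λ K → work-bound) total-load

  fence-exact : ∀ {K} → K ℕ.≤ m → fence K ≡ ⟦ lℕ B K ⟧
  fence-exact {K} K≤m = ℚP.≤-antisym (fence≤l (fence-post K≤m)) (begin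
      ⟦ lℕ B K ⟧                               ≡⟨ cong ⟦_⟧ (l-closed K) ⟩
      ⟦ K ℕ.* B³ ℕ.+ weighted (λ _ → B) K ⟧    ≡⟨ cong (λ w → ⟦ K ℕ.* B³ ℕ.+ w ⟧) equal-loads ⟨
      ⟦ K ℕ.* B³ ℕ.+ weighted N K ⟧            ≤⟨ work-fits K≤m ⟩
      fence K                                  ∎)
    where
    open ℚP.≤-Reasoning
    equal-loads : weighted N K ≡ weighted (λ _ → B) K
    equal-loads = ∑-cong K (λ k k<K → cong (suc k ℕ.*_) (loads-exact k (ℕP.<-≤-trans k<K K≤m)))

  J̃-on-time : ∀ i → start (inj₂ i) ≡ ⟦ lℕ B (toℕ i) ⟧
  J̃-on-time i = trans (sym (fence-J̃ i)) (fence-exact (ℕP.<⇒≤ (toℕ<n i)))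

  gap-end : ∀ i → gapEnd B m (start ∘ inj₂) i ≡ ⟦ lℕ B (suc (toℕ i)) ⟧
  gap-end i = trans (gapEnd≡fence i) (fence-exact (toℕ<n i))

-- the operators of the statement, opened only here because the modules above use the
-- rational ones under the same names
open import Data.Nat using (_<_; _*_; _+_)
open import Data.Rational using (_-_)
import Data.Rational as ℚ

lemma8 : (B m : ℕ) → 0 < B → 0 < m → m < B →
         (a : Fin (3 * m) → ℕ) →
         (∀ j → 0 < a j) →
         sum (tabulate a) ≡ m * B →
         (∀ j → B < 4 * a j) → (∀ j → 2 * a j < B) →
         (D : FeasibleSchedule B m a) →
         ∀ (i : Fin m) →
           gapEnd B m (λ k → FeasibleSchedule.start D (inj₂ k)) i
             - FeasibleSchedule.comp D (inj₂ i)
           ≡ ⟦ suc (toℕ i) * B ⟧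
lemma8 B m _ _ m<B a a>0 a-total _ _ D i = begin
    gapEnd B m (λ k → start (inj₂ k)) i - comp (inj₂ i)
  ≡⟨ cong₂ _-_ (gap-end i) (comp-J̃ i) ⟩
    ⟦ lℕ B (suc (toℕ i)) ⟧ - (start (inj₂ i) ℚ.+ ⟦ B³ ⟧)
  ≡⟨ cong (λ s → ⟦ lℕ B (suc (toℕ i)) ⟧ - (s ℚ.+ ⟦ B³ ⟧)) (J̃-on-time i) ⟩
    ⟦ lℕ B (suc (toℕ i)) ⟧ - (⟦ lℕ B (toℕ i) ⟧ ℚ.+ ⟦ B³ ⟧)
  ≡⟨ WindowGaps.window-gap B (toℕ i) ⟩
    ⟦ suc (toℕ i) * B ⟧ ∎
  where
  open FeasibleSchedule D
  open Analysis B m m<B a a>0 a-total D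
  open ≡-Reasoning
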